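{- Consider the signature $\Sigma_U=\{0,-,\mathrm{app},+,\cdot\}$ where $0$ is a constant, $-$ is unary minus, $\mathrm{app}$ is a unary function symbol (unary append, written postfix as $x1$ in the paper, semantically $x+1$), and $+,\cdot$ are binary. Let $N_1$ be the term rewriting system over $\Sigma_U\setminus\{ -\}$ given by the left-to-right oriented equations [U1] $x+0=x$; [U2] $x+\mathrm{app}(y)=\mathrm{app}(x)+y$; [U3] $x\cdot 0=0$; [U4] $x\cdot\mathrm{app}(y)=x+(x\cdot y)$, and let $Z_1$ be the term rewriting system over $\Sigma_U$ consisting of [U1]--[U4] together with [U5] $-0=0$; [U6] $\mathrm{app}(-\mathrm{app}(x))=-x$; [U7] $-(-x)=x$; [U8] $x+(-y)=-((-x)+y)$; [U9] $x\cdot(-y)=-(x\cdot y)$. Then $N_1$ and $Z_1$ are strongly terminating.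
   Context: Equations are read as rewrite rules from left to right with variables $x,y$. Strongly terminating means there is no infinite rewrite sequence. -}

module Defs where

open import Data.Nat using (ℕ)
open import Data.Bool using (Bool; true; false)
open import Induction.WellFounded using (WellFounded)

-- The index says whether unary minus is available:
--   Term false : terms over Σ_U \ {-}   (the signature of N₁)
--   Term true  : terms over Σ_U         (the signature of Z₁)
data Term : Bool → Set where
  var  : ∀ {b} → ℕ → Term b
  zero : ∀ {b} → Term b
  neg  : Term true → Term true
  app  : ∀ {b} → Term b → Term b
  _⊕_  : ∀ {b} → Term b → Term b → Term b
  _⊙_  : ∀ {b} → Term b → Term b → Term b

infixl 6 _⊕_
infixl 7 _⊙_

Subst : Bool → Set
Subst b = ℕ → Term b

_[_] : ∀ {b} → Term b → Subst b → Term b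
var n   [ σ ] = σ n
zero    [ σ ] = zero
neg t   [ σ ] = neg (t [ σ ])
app t   [ σ ] = app (t [ σ ])
(s ⊕ t) [ σ ] = (s [ σ ]) ⊕ (t [ σ ])
(s ⊙ t) [ σ ] = (s [ σ ]) ⊙ (t [ σ ])

Rules : Bool → Set₁
Rules b = Term b → Term b → Set

data Step : {b : Bool} (R : Rules b) → Term b → Term b → Set₁ where
  root  : ∀ {b} {R : Rules b} {l r} (σ : Subst b) → R l r → Step R (l [ σ ]) (r [ σ ])
  negC  : ∀ {R : Rules true} {s t} → Step R s t → Step R (neg s) (neg t)
  appC  : ∀ {b} {R : Rules b} {s t} → Step R s t → Step R (app s) (app t)
  ⊕ˡ    : ∀ {b} {R : Rules b} {s t u} → Step R s t → Step R (s ⊕ u) (t ⊕ u)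
  ⊕ʳ    : ∀ {b} {R : Rules b} {s t u} → Step R s t → Step R (u ⊕ s) (u ⊕ t)
  ⊙ˡ    : ∀ {b} {R : Rules b} {s t u} → Step R s t → Step R (s ⊙ u) (t ⊙ u)
  ⊙ʳ    : ∀ {b} {R : Rules b} {s t u} → Step R s t → Step R (u ⊙ s) (u ⊙ t)

StronglyTerminating : ∀ {b} → Rules b → Set₁
StronglyTerminating {b} R = WellFounded (λ (t s : Term b) → Step R s t)

private
  x y : ∀ {b} → Term b
  x = var 0
  y = var 1

data U1-4 {b : Bool} : Rules b where
  U1 : U1-4 (x ⊕ zero) x
  U2 : U1-4 (x ⊕ app y) (app x ⊕ y)
  U3 : U1-4 (x ⊙ zero) zero
  U4 : U1-4 (x ⊙ app y) (x ⊕ (x ⊙ y))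

N₁ : Rules false
N₁ = U1-4

data Z₁ : Rules true where
  base : ∀ {l r} → U1-4 l r → Z₁ l r
  U5 : Z₁ (neg zero) zero
  U6 : Z₁ (app (neg (app x))) (neg x)
  U7 : Z₁ (neg (neg x)) x
  U8 : Z₁ (x ⊕ neg y) (neg (neg x ⊕ y))
  U9 : Z₁ (x ⊙ neg y) (neg (x ⊙ y))

-- Interpret terms in ℕ: variables and 0 by 2, both unary symbols by successor,
-- x + y by x·2^y, and x · y by the tower  x·0 = x,  x·(y+1) = 1 + x·2^(x·y),
-- which is what [U4] and [U9] demand. All values are at least 2, on such values
-- the interpretation is strictly monotone in every argument, and every instance
-- of [U1]–[U9] has a strictly smaller right-hand side; hence every rewrite step
-- strictly decreases the value.
module Submission where

open import Defs
open import Data.Product using (_×_; _,_)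
open import Data.Nat using (ℕ; zero; suc; _+_; _*_; _^_; _≤_; _<_; _<′_; ≤′-refl; ≤′-step; z≤n; s≤s; z<s; >-nonZero)
open import Data.Nat.Properties
open import Data.Nat.Induction using (<-wellFounded)
open import Induction.WellFounded using (module Subrelation)
open import Relation.Binary.PropositionalEquality using (_≡_; sym; cong; module ≡-Reasoning)
import Relation.Binary.Construct.On as On

strictMono-from-step : (f : ℕ → ℕ) → (∀ n → f n < f (suc n)) →
                       ∀ {m n} → m < n → f m < f n
strictMono-from-step f step m<n = go (<⇒<′ m<n)
  where
  go : ∀ {m n} → m <′ n → f m < f n
  go {m} ≤′-refl   = step m
  go (≤′-step m<n) = <-trans (go m<n) (step _)

n<2^n : ∀ n → n < 2 ^ n
n<2^n zero    = z<s
n<2^n (suc n) = begin-strict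
  suc n         ≤⟨ n<2^n n ⟩
  2 ^ n         <⟨ m<m+n (2 ^ n) (m^n>0 2 n) ⟩
  2 ^ n + 2 ^ n ≡⟨ cong (2 ^ n +_) (sym (+-identityʳ (2 ^ n))) ⟩
  2 ^ suc n     ∎
  where open ≤-Reasoning

add : ℕ → ℕ → ℕ
add x y = x * 2 ^ y

mul : ℕ → ℕ → ℕ
mul x zero    = x
mul x (suc y) = suc (add x (mul x y))

add-sucʳ : ∀ x y → add x (suc y) ≡ add x y + add x y
add-sucʳ x y = begin
  x * (2 ^ y + (2 ^ y + 0)) ≡⟨ cong (λ k → x * (2 ^ y + k)) (+-identityʳ (2 ^ y)) ⟩
  x * (2 ^ y + 2 ^ y)       ≡⟨ *-distribˡ-+ x (2 ^ y) (2 ^ y) ⟩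
  add x y + add x y         ∎
  where open ≡-Reasoning

x≤add : ∀ x y → x ≤ add x y
x≤add x y = m≤m*n x (2 ^ y) {{m^n≢0 2 y}}

y<add : ∀ {x} y → 1 ≤ x → y < add x y
y<add {x} y 1≤x = <-≤-trans (n<2^n y) (m≤n*m (2 ^ y) x {{>-nonZero 1≤x}})

add-monoˡ-< : ∀ {x x'} y → x < x' → add x y < add x' y
add-monoˡ-< y = *-monoˡ-< (2 ^ y) {{m^n≢0 2 y}}

add-monoʳ-≤ : ∀ x {y y'} → y ≤ y' → add x y ≤ add x y'
add-monoʳ-≤ x y≤y' = *-monoʳ-≤ x (^-monoʳ-≤ 2 y≤y')

add-monoʳ-< : ∀ {x y y'} → 1 ≤ x → y < y' → add x y < add x y'
add-monoʳ-< {x} 1≤x y<y' = *-monoʳ-< x {{>-nonZero 1≤x}} (^-monoʳ-< 2 (s≤s (s≤s z≤n)) y<y')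

-- The common shape of the right-hand sides of [U2] (k = 1) and [U8] (k = 2).
add-shift : ∀ {k x} y → 2 ≤ x → k ≤ 2 ^ y → k + add (suc x) y ≤ add x (suc y)
add-shift {k} {x} y 2≤x k≤2^y = begin
  k + (2 ^ y + add x y)   ≡⟨ sym (+-assoc k (2 ^ y) (add x y)) ⟩
  k + 2 ^ y + add x y     ≤⟨ +-monoˡ-≤ (add x y) k+2^y≤add ⟩
  add x y + add x y       ≡⟨ sym (add-sucʳ x y) ⟩
  add x (suc y)           ∎
  where
  open ≤-Reasoning
  k+2^y≤add : k + 2 ^ y ≤ add x y
  k+2^y≤add = begin
    k + 2 ^ y             ≤⟨ +-monoˡ-≤ (2 ^ y) k≤2^y ⟩
    2 ^ y + 2 ^ y         ≡⟨ cong (2 ^ y +_) (sym (+-identityʳ (2 ^ y))) ⟩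
    2 * 2 ^ y             ≤⟨ *-monoˡ-≤ (2 ^ y) 2≤x ⟩
    add x y               ∎

mul-step : ∀ {x} y → 1 ≤ x → mul x y < mul x (suc y)
mul-step y 1≤x = m<n⇒m<1+n (y<add (mul _ y) 1≤x)

mul-monoʳ-< : ∀ {x y y'} → 1 ≤ x → y < y' → mul x y < mul x y'
mul-monoʳ-< 1≤x = strictMono-from-step (mul _) (λ y → mul-step y 1≤x)

x≤mul : ∀ {x} y → 1 ≤ x → x ≤ mul x y
x≤mul zero    1≤x = ≤-refl
x≤mul (suc y) 1≤x = <⇒≤ (mul-monoʳ-< {y' = suc y} 1≤x z<s)

mul-monoˡ-< : ∀ {x x'} y → x < x' → mul x y < mul x' y
mul-monoˡ-< zero    x<x' = x<x'
mul-monoˡ-< {x} {x'} (suc y) x<x' = s≤s (begin-strict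
  add x (mul x y)         ≤⟨ add-monoʳ-≤ x (<⇒≤ (mul-monoˡ-< y x<x')) ⟩
  add x (mul x' y)        <⟨ add-monoˡ-< (mul x' y) x<x' ⟩
  add x' (mul x' y)       ∎)
  where open ≤-Reasoning

⟦_⟧ : ∀ {b} → Term b → ℕ
⟦ var _ ⟧ = 2
⟦ zero ⟧  = 2
⟦ neg t ⟧ = suc ⟦ t ⟧
⟦ app t ⟧ = suc ⟦ t ⟧
⟦ s ⊕ t ⟧ = add ⟦ s ⟧ ⟦ t ⟧
⟦ s ⊙ t ⟧ = mul ⟦ s ⟧ ⟦ t ⟧

2≤⟦⟧ : ∀ {b} (t : Term b) → 2 ≤ ⟦ t ⟧
2≤⟦⟧ (var _) = ≤-refl
2≤⟦⟧ zero    = ≤-refl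
2≤⟦⟧ (neg t) = m≤n⇒m≤1+n (2≤⟦⟧ t)
2≤⟦⟧ (app t) = m≤n⇒m≤1+n (2≤⟦⟧ t)
2≤⟦⟧ (s ⊕ t) = ≤-trans (2≤⟦⟧ s) (x≤add ⟦ s ⟧ ⟦ t ⟧)
2≤⟦⟧ (s ⊙ t) = ≤-trans (2≤⟦⟧ s) (x≤mul ⟦ t ⟧ (<⇒≤ (2≤⟦⟧ s)))

1≤⟦⟧ : ∀ {b} (t : Term b) → 1 ≤ ⟦ t ⟧
1≤⟦⟧ t = <⇒≤ (2≤⟦⟧ t)

Decreasing : ∀ {b} → Rules b → Set
Decreasing {b} R = ∀ {l r} (σ : Subst b) → R l r → ⟦ r [ σ ] ⟧ < ⟦ l [ σ ] ⟧

step-decreasing : ∀ {b} {R : Rules b} → Decreasing R → ∀ {s t} → Step R s t → ⟦ t ⟧ < ⟦ s ⟧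
step-decreasing dec (root σ l⟶r) = dec σ l⟶r
step-decreasing dec (negC s⟶t)   = s≤s (step-decreasing dec s⟶t)
step-decreasing dec (appC s⟶t)   = s≤s (step-decreasing dec s⟶t)
step-decreasing dec (⊕ˡ {u = u} s⟶t) = add-monoˡ-< ⟦ u ⟧ (step-decreasing dec s⟶t)
step-decreasing dec (⊕ʳ {u = u} s⟶t) = add-monoʳ-< (1≤⟦⟧ u) (step-decreasing dec s⟶t)
step-decreasing dec (⊙ˡ {u = u} s⟶t) = mul-monoˡ-< ⟦ u ⟧ (step-decreasing dec s⟶t)
step-decreasing dec (⊙ʳ {u = u} s⟶t) = mul-monoʳ-< (1≤⟦⟧ u) (step-decreasing dec s⟶t)

decreasing⇒stronglyTerminating : ∀ {b} {R : Rules b} → Decreasing R → StronglyTerminating R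
decreasing⇒stronglyTerminating dec =
  Subrelation.wellFounded (step-decreasing dec) (On.wellFounded ⟦_⟧ <-wellFounded)

U1-4-decreasing : ∀ {b} → Decreasing (U1-4 {b})
U1-4-decreasing σ U1 = m<m*n ⟦ σ 0 ⟧ 4 {{>-nonZero (1≤⟦⟧ (σ 0))}} (s≤s (s≤s z≤n))
U1-4-decreasing σ U2 = add-shift ⟦ σ 1 ⟧ (2≤⟦⟧ (σ 0)) (m^n>0 2 ⟦ σ 1 ⟧)
U1-4-decreasing σ U3 = ≤-<-trans (2≤⟦⟧ (σ 0)) (mul-monoʳ-< {y' = 2} (1≤⟦⟧ (σ 0)) z<s)
U1-4-decreasing σ U4 = ≤-refl

Z₁-decreasing : Decreasing Z₁
Z₁-decreasing σ (base l⟶r) = U1-4-decreasing σ l⟶r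
Z₁-decreasing σ U5 = ≤-refl
Z₁-decreasing σ U6 = m<n⇒m<1+n (n<1+n _)
Z₁-decreasing σ U7 = m<n⇒m<1+n (n<1+n _)
Z₁-decreasing σ U8 = add-shift ⟦ σ 1 ⟧ (2≤⟦⟧ (σ 0)) (^-monoʳ-≤ 2 (1≤⟦⟧ (σ 1)))
Z₁-decreasing σ U9 = s≤s (y<add (mul ⟦ σ 0 ⟧ ⟦ σ 1 ⟧) (1≤⟦⟧ (σ 0)))

lemma3p1p1 : StronglyTerminating N₁ × StronglyTerminating Z₁
lemma3p1p1 = decreasing⇒stronglyTerminating U1-4-decreasing
           , decreasing⇒stronglyTerminating Z₁-decreasing
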